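{- Let $\star\in\{+,-\}$, let $G$ be a graph and $v\in V(G)$, where if $\star=+$ we additionally require that $v$ is not an isolated vertex. Let $G^-$ be obtained from $G$ by adding a new vertex $v^-$ with $N_{G^- }(v^-)=N_G(v)$ (independent duplication), and $G^+$ be obtained from $G$ by adding a new vertex $v^+$ with $N_{G^+}(v^+)=N_G[v]=N_G(v)\cup\{v\}$ (join-duplication). Let $P_2$ have vertex set $\{v,v^\star\}$. Then $\mathcal{TE}_\star(G^\star)\cong(\mathcal{TE}_\star(G)\,\square\,P_2)/\!\sim$, and (when $v$ is not isolated) $\mathcal{TS}_+(G^+)\cong(\mathcal{TS}_+(G)\,\square\,P_2)/\!\sim$, and $\mathcal{TS}_-(G^-)\cong(2\,\mathcal{TS}_-(G))/\!\sim$, where in each case, for $B\in V(\mathcal{TE}_\star(G))$, $(B,v)\sim(B,v^\star)$ if and only if $v\in B$ (and $\sim$ is otherwise trivial). In $2\,\mathcal{TS}_-(G)$, the two disjoint copies of $\mathcal{TS}_-(G)$ have vertices written $(B,v)$ and $(B,v^-)$ respectively, for $B\in V(\mathcal{TS}_-(G))$.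
   Context: $\square$ is the Cartesian product. For a graph $H$ and an equivalence relation $\sim$ on $V(H)$, the quotient graph $H/\!\sim$ has the equivalence classes as vertices, with distinct classes $[a],[b]$ adjacent iff some $a'\in[a]$, $b'\in[b]$ are adjacent in $H$. PSD forcing on $G$: from an initial blue set $B$, repeatedly apply: if $C$ is a connected component of the graph obtained from $G$ by deleting the currently blue vertices and $u$ is a blue vertex with $N_G(u)\cap V(C)=\{w\}$, then $w$ becomes blue; $\mathrm{Z}_+(G)$ is the minimum size of a set making all vertices blue. Skew forcing: from an initial blue set (possibly empty), repeatedly apply: if any vertex $u$ (blue or white) has exactly one white neighbor $w$, then $w$ becomes blue; $\mathrm{Z}_-(G)$ is the minimum size of a set making all vertices blue. For $\star\in\{+,-\}$, $\mathcal{TE}_\star(G)$ has as vertices the minimum $\mathrm{Z}_\star$-forcing sets (size $\mathrm{Z}_\star(G)$), with $S_1S_2$ an edge iff there are $v_1\in S_1\setminus S_2$, $v_2\in S_2\setminus S_1$ with $S_1\setminus\{v_1\}=S_2\setminus\{v_2\}$; $\mathcal{TS}_\star(G)$ has the same vertices with the additional requirement $v_1v_2\in E(G)$. -}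

module Defs where

open import Data.Nat using (ℕ; zero; suc; _≤_)
open import Data.Bool using (Bool; true; false; _∨_; _∧_)
open import Data.Fin using (Fin; zero; suc; _≟_)
open import Data.Fin.Subset using (Subset; _∈_; _∉_; _∪_; ⁅_⁆; _-_; ∣_∣; ⊤)
open import Data.Product using (Σ; ∃; _×_; _,_)
open import Data.Sum using (_⊎_)
open import Relation.Nullary using (¬_)
open import Relation.Nullary.Decidable using (⌊_⌋)
open import Relation.Binary.PropositionalEquality using (_≡_; _≢_; refl)
open import Level using (Level; _⊔_) renaming (suc to lsuc)

record Graph (n : ℕ) : Set where
  field
    adj    : Fin n → Fin n → Bool
    sym    : ∀ u w → adj u w ≡ adj w u
    irrefl : ∀ u → adj u u ≡ false
open Graph public

Adj : ∀ {n} → Graph n → Fin n → Fin n → Set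
Adj G u w = adj G u w ≡ true

NonIsolated : ∀ {n} → Graph n → Fin n → Set
NonIsolated G v = ∃ λ u → Adj G v u

-- The new vertex v^⋆ is `zero`,
-- an old vertex x of G is `suc x`.
-- joined = false : independent duplication G^-   (N(v^-) = N_G(v))
-- joined = true  : join-duplication G^+           (N(v^+) = N_G[v])

private
  newAdj : ∀ {n} → Bool → Graph n → Fin n → Fin n → Bool
  newAdj joined G v x = adj G v x ∨ (joined ∧ ⌊ v ≟ x ⌋)

  dAdj : ∀ {n} → Bool → Graph n → Fin n → Fin (suc n) → Fin (suc n) → Bool
  dAdj j G v zero    zero    = false
  dAdj j G v zero    (suc y) = newAdj j G v y
  dAdj j G v (suc x) zero    = newAdj j G v x
  dAdj j G v (suc x) (suc y) = adj G x y

  dSym : ∀ {n} j (G : Graph n) v u w → dAdj j G v u w ≡ dAdj j G v w u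
  dSym j G v zero    zero    = refl
  dSym j G v zero    (suc y) = refl
  dSym j G v (suc x) zero    = refl
  dSym j G v (suc x) (suc y) = sym G x y

  dIrr : ∀ {n} j (G : Graph n) v u → dAdj j G v u u ≡ false
  dIrr j G v zero    = refl
  dIrr j G v (suc x) = irrefl G x

duplicate : ∀ {n} → Bool → Graph n → Fin n → Graph (suc n)
duplicate j G v = record { adj = dAdj j G v ; sym = dSym j G v ; irrefl = dIrr j G v }

-- The two forcing processes.  pos = PSD forcing (Z₊), neg = skew forcing (Z₋)

data Sgn : Set where
  pos neg : Sgn

dup : ∀ {n} → Sgn → Graph n → Fin n → Graph (suc n)
dup pos = duplicate true
dup neg = duplicate false

-- WPath G S x y : x and y lie in the same connected component of G - S
-- (a path all of whose vertices are white, i.e. not in S).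
data WPath {n} (G : Graph n) (S : Subset n) : Fin n → Fin n → Set where
  here : ∀ {x} → x ∉ S → WPath G S x x
  step : ∀ {x y z} → x ∉ S → Adj G x y → WPath G S y z → WPath G S x z

Force : ∀ {n} → Sgn → Graph n → Subset n → Fin n → Set
Force pos G S w =
  w ∉ S × ∃ λ u → u ∈ S × Adj G u w ×
    (∀ x → Adj G u x → WPath G S w x → x ≡ w)
Force neg G S w =
  w ∉ S × ∃ λ u → Adj G u w × (∀ x → Adj G u x → x ∉ S → x ≡ w)

data Reach {n} (s : Sgn) (G : Graph n) : Subset n → Subset n → Set where
  done : ∀ {S} → Reach s G S S
  step : ∀ {S T} w → Force s G S w → Reach s G (S ∪ ⁅ w ⁆) T → Reach s G S T

IsForcing : ∀ {n} → Sgn → Graph n → Subset n → Set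
IsForcing s G B = Reach s G B ⊤

IsMinForcing : ∀ {n} → Sgn → Graph n → Subset n → Set
IsMinForcing s G B = IsForcing s G B × (∀ T → IsForcing s G T → ∣ B ∣ ≤ ∣ T ∣)

-- Abstract graphs: a vertex type V, a predicate carving out the actual
-- vertices, an equality of vertices (an equivalence), and an edge relation.

record AGraph : Set₁ where
  field
    V    : Set
    Vert : V → Set
    _≈_  : V → V → Set
    E    : V → V → Set
open AGraph public

-- Graph isomorphism (edges in all graphs below are invariant under ≈)
record _≅_ (H K : AGraph) : Set where
  field
    f     : V H → V K
    pres  : ∀ {x} → Vert H x → Vert K (f x)
    eqv   : ∀ {x y} → Vert H x → Vert H y → (_≈_ H x y → _≈_ K (f x) (f y)) × (_≈_ K (f x) (f y) → _≈_ H x y)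
    surj  : ∀ y → Vert K y → ∃ λ x → Vert H x × _≈_ K (f x) y
    edges : ∀ {x y} → Vert H x → Vert H y → (E H x y → E K (f x) (f y)) × (E K (f x) (f y) → E H x y)

TEEdge : ∀ {n} → Subset n → Subset n → Set
TEEdge S₁ S₂ = ∃ λ v₁ → ∃ λ v₂ →
  v₁ ∈ S₁ × v₁ ∉ S₂ × v₂ ∈ S₂ × v₂ ∉ S₁ × (S₁ - v₁) ≡ (S₂ - v₂)

TSEdge : ∀ {n} → Graph n → Subset n → Subset n → Set
TSEdge G S₁ S₂ = ∃ λ v₁ → ∃ λ v₂ →
  v₁ ∈ S₁ × v₁ ∉ S₂ × v₂ ∈ S₂ × v₂ ∉ S₁ × (S₁ - v₁) ≡ (S₂ - v₂) × Adj G v₁ v₂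

TE : ∀ {n} → Sgn → Graph n → AGraph
TE s G = record { V = Subset _ ; Vert = IsMinForcing s G ; _≈_ = _≡_ ; E = TEEdge }

TS : ∀ {n} → Sgn → Graph n → AGraph
TS s G = record { V = Subset _ ; Vert = IsMinForcing s G ; _≈_ = _≡_ ; E = TSEdge G }

-- H □ P₂, where P₂ has vertex set Bool : false ↔ v, true ↔ v^⋆
_□P₂ : AGraph → AGraph
H □P₂ = record
  { V = V H × Bool
  ; Vert = λ { (x , i) → Vert H x }
  ; _≈_ = _≡_
  ; E = λ { (x , i) (y , j) → (x ≡ y × i ≢ j) ⊎ (E H x y × i ≡ j) }
  }

2· : AGraph → AGraph
2· H = record
  { V = V H × Bool
  ; Vert = λ { (x , i) → Vert H x }
  ; _≈_ = _≡_
  ; E = λ { (x , i) (y , j) → E H x y × i ≡ j }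
  }

-- Quotient graph H / R (R an equivalence relation on vertices coarser than ≈):
-- classes are the vertices, distinct classes adjacent iff some representatives are.
_/_ : (H : AGraph) → (V H → V H → Set) → AGraph
H / R = record
  { V = V H
  ; Vert = Vert H
  ; _≈_ = R
  ; E = λ a b → ¬ R a b × ∃ λ a' → ∃ λ b' →
          Vert H a' × Vert H b' × R a a' × R b b' × E H a' b'
  }

∼[_] : ∀ {n} → Fin n → Subset n × Bool → Subset n × Bool → Set
∼[ v ] (B , i) (B' , j) = B ≡ B' × (i ≡ j ⊎ v ∈ B)

-- In G⋆ the vertices v and v⋆ are twins, so swapping them is an automorphism σ and
-- forcing is σ-invariant.  While both twins are white neither can be forced: a vertex
-- seeing one twin sees both, and for PSD forcing the edge v⁺v puts them in one white
-- component.  So a forcing set of G⋆ contains v⋆, or contains v and is the σ-image of one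
-- that does; and B + v⋆ forces G⋆ iff B forces G (a force by v⁺ can be simulated in G as
-- long as v is not isolated).  Hence Z⋆(G⋆) = Z⋆(G) + 1 and the minimum forcing sets of G⋆
-- are B + v⋆ and, for v ∉ B, B + v, with B minimum in G: exactly one set per class of ∼.
-- A token exchange either trades v⋆ for v, which is the P₂-edge, or stays inside a layer,
-- v⋆ standing in for v.

module Submission where

open import Defs
open import Data.Nat using (suc; _≤_; s≤s; s≤s⁻¹)
open import Data.Nat.Properties using (≤-trans; ≤-reflexive)
open import Data.Bool using (Bool; true; false; T; _∨_)
open import Data.Bool.Properties using (∨-identityʳ; ∧-zeroʳ; ∧-identityʳ)
open import Data.Empty using (⊥-elim)
open import Data.Unit using (tt)
open import Data.Fin using (Fin; zero; suc; _≟_)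
open import Data.Fin.Properties using (suc-injective)
open import Data.Fin.Subset using (Subset; _∈_; _∉_; _∪_; ⁅_⁆; _-_; ∣_∣; ⊤)
open import Data.Fin.Subset.Properties
  using (_∈?_; drop-there; drop-not-there; ∈⊤; x∈⁅x⁆; x∈⁅y⁆⇒x≡y; x∈p∪q⁻; x∈p∪q⁺; ⊆-antisym; p─q⊆p; p─⊥≡p;
         x∈p∧x≢y⇒x∈p-y; p─x─y≡p─y─x)
open import Data.Vec using (_∷_; tail)
open import Data.Vec.Base using (here; there)
open import Data.Vec.Properties using (∷-injectiveˡ; ∷-injectiveʳ)
open import Data.Product using (∃; _×_; _,_; proj₁; proj₂)
open import Data.Sum using (_⊎_; inj₁; inj₂)
open import Function using (_∘_)
open import Function.Bundles using (_⇔_; mk⇔; Equivalence)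
open import Function.Properties.Equivalence using () renaming (sym to ⇔-sym; trans to ⇔-trans)
open import Relation.Nullary using (¬_; yes; no)
open import Relation.Binary.PropositionalEquality
  using (_≡_; _≢_; refl; trans; cong; subst) renaming (sym to ≡sym)

open Equivalence using (to; from)

module _ {m} {p : Subset m} where

  x∈p∪⁅y⁆⁻ : ∀ {x} y → x ∈ p ∪ ⁅ y ⁆ → x ∈ p ⊎ x ≡ y
  x∈p∪⁅y⁆⁻ y h with x∈p∪q⁻ p ⁅ y ⁆ h
  ... | inj₁ x∈p = inj₁ x∈p
  ... | inj₂ x∈y = inj₂ (x∈⁅y⁆⇒x≡y y x∈y)

  x∈p∪⁅y⁆⁺ : ∀ {x} y → x ∈ p ⊎ x ≡ y → x ∈ p ∪ ⁅ y ⁆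
  x∈p∪⁅y⁆⁺ y (inj₁ x∈p) = x∈p∪q⁺ (inj₁ x∈p)
  x∈p∪⁅y⁆⁺ y (inj₂ refl) = x∈p∪q⁺ {p = p} (inj₂ (x∈⁅x⁆ y))

  x∈p-y⇒x∈p : ∀ {x y} → x ∈ p - y → x ∈ p
  x∈p-y⇒x∈p {y = y} = p─q⊆p p ⁅ y ⁆

x∉p-x : ∀ {m} (p : Subset m) x → x ∉ p - x
x∉p-x (_ ∷ p) zero ()
x∉p-x (_ ∷ p) (suc x) (there h) = x∉p-x p x h

x∈p-y⇒x≢y : ∀ {m} {p : Subset m} {x y} → x ∈ p - y → x ≢ y
x∈p-y⇒x≢y {p = p} h refl = x∉p-x p _ h

x∉p⇒x∉p-y : ∀ {m} {p : Subset m} {x y} → x ∉ p → x ∉ p - y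
x∉p⇒x∉p-y x∉p = x∉p ∘ x∈p-y⇒x∈p

∣p∣≡1+∣p-x∣ : ∀ {m} (p : Subset m) x → x ∈ p → ∣ p ∣ ≡ suc ∣ p - x ∣
∣p∣≡1+∣p-x∣ (true ∷ p) zero here = cong suc (cong ∣_∣ (≡sym (p─⊥≡p p)))
∣p∣≡1+∣p-x∣ (true ∷ p) (suc x) (there h) = cong suc (∣p∣≡1+∣p-x∣ p x h)
∣p∣≡1+∣p-x∣ (false ∷ p) (suc x) (there h) = ∣p∣≡1+∣p-x∣ p x h

p-x≡q-x⇒p≡q : ∀ {m} {p q : Subset m} {x} → x ∈ p → x ∈ q → p - x ≡ q - x → p ≡ q
p-x≡q-x⇒p≡q {p = p} {q} {x} x∈p x∈q e = ⊆-antisym (transfer x∈q e) (transfer x∈p (≡sym e))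
  where
  transfer : ∀ {r t} → x ∈ t → r - x ≡ t - x → ∀ {i} → i ∈ r → i ∈ t
  transfer x∈t e {i} i∈r with i ≟ x
  ... | yes refl = x∈t
  ... | no i≢x = x∈p-y⇒x∈p (subst (i ∈_) e (x∈p∧x≢y⇒x∈p-y i∈r i≢x))

p∪⁅x⁆-x≡p : ∀ {m} {p : Subset m} {x} → x ∉ p → p ∪ ⁅ x ⁆ - x ≡ p
p∪⁅x⁆-x≡p {p = p} {x} x∉p =
  ⊆-antisym shrink (λ i∈p → x∈p∧x≢y⇒x∈p-y (x∈p∪⁅y⁆⁺ x (inj₁ i∈p)) λ { refl → x∉p i∈p })
  where
  shrink : ∀ {i} → i ∈ p ∪ ⁅ x ⁆ - x → i ∈ p
  shrink h with x∈p∪⁅y⁆⁻ x (x∈p-y⇒x∈p h)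
  ... | inj₁ i∈p = i∈p
  ... | inj₂ refl = ⊥-elim (x∉p-x _ x h)

Exchange : ∀ {m} → (Fin m → Fin m → Set) → Subset m → Subset m → Set
Exchange P S₁ S₂ = ∃ λ v₁ → ∃ λ v₂ →
  v₁ ∈ S₁ × v₁ ∉ S₂ × v₂ ∈ S₂ × v₂ ∉ S₁ × (S₁ - v₁) ≡ (S₂ - v₂) × P v₁ v₂

-- TE-edges are exchanges with any label (c = false), TS-edges exchanges along edges (c = true).
Label : ∀ {m} → Bool → Graph m → Fin m → Fin m → Set
Label c H a b = T c → Adj H a b

Label-sym : ∀ {m} c (H : Graph m) a b → Label c H a b → Label c H b a
Label-sym c H a b ℓ t = trans (sym H b a) (ℓ t)

module _ {m} {P : Fin m → Fin m → Set} where

  Exchange-map : ∀ {Q : Fin m → Fin m → Set} → (∀ {a b} → P a b → Q a b) →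
                 ∀ {S₁ S₂} → Exchange P S₁ S₂ → Exchange Q S₁ S₂
  Exchange-map f (a , b , a∈ , a∉ , b∈ , b∉ , e , p) = a , b , a∈ , a∉ , b∈ , b∉ , e , f p

  Exchange-sym : (∀ a b → P a b → P b a) → ∀ {S₁ S₂} → Exchange P S₁ S₂ → Exchange P S₂ S₁
  Exchange-sym P-sym (a , b , a∈ , a∉ , b∈ , b∉ , e , p) = b , a , b∈ , b∉ , a∈ , a∉ , ≡sym e , P-sym a b p

  Exchange-leaving : ∀ {S₁ S₂ x} → x ∈ S₁ → x ∉ S₂ → Exchange P S₁ S₂ →
                     ∃ λ b → b ∈ S₂ × b ∉ S₁ × S₁ - x ≡ S₂ - b × P x b
  Exchange-leaving {x = x} x∈ x∉ (a , b , _ , _ , b∈ , b∉ , e , p) with x ≟ a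
  ... | yes refl = b , b∈ , b∉ , e , p
  ... | no x≢a = ⊥-elim (x∉ (x∈p-y⇒x∈p (subst (x ∈_) e (x∈p∧x≢y⇒x∈p-y x∈ x≢a))))

  Exchange-swap : ∀ {S a b} → a ∈ S → b ∈ S → a ≢ b → P a b → Exchange P (S - b) (S - a)
  Exchange-swap {S} {a} {b} a∈ b∈ a≢b p =
    a , b , x∈p∧x≢y⇒x∈p-y a∈ a≢b , x∉p-x S a , x∈p∧x≢y⇒x∈p-y b∈ (a≢b ∘ ≡sym) , x∉p-x S b ,
    p─x─y≡p─y─x S b a , p

  Exchange-remove : ∀ {S₁ S₂ x} → x ∈ S₁ → x ∈ S₂ → Exchange P S₁ S₂ ⇔ Exchange P (S₁ - x) (S₂ - x)
  Exchange-remove {S₁} {S₂} {x} x∈S₁ x∈S₂ = mk⇔ remove restore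
    where
    remove : Exchange P S₁ S₂ → Exchange P (S₁ - x) (S₂ - x)
    remove (a , b , a∈ , a∉ , b∈ , b∉ , e , p) =
      a , b , x∈p∧x≢y⇒x∈p-y a∈ a≢x , x∉p⇒x∉p-y a∉ , x∈p∧x≢y⇒x∈p-y b∈ b≢x , x∉p⇒x∉p-y b∉ ,
      trans (p─x─y≡p─y─x S₁ x a) (trans (cong (_- x) e) (p─x─y≡p─y─x S₂ b x)) , p
      where
      a≢x : a ≢ x
      a≢x refl = a∉ x∈S₂
      b≢x : b ≢ x
      b≢x refl = b∉ x∈S₁
    restore : Exchange P (S₁ - x) (S₂ - x) → Exchange P S₁ S₂
    restore (a , b , a∈ , a∉ , b∈ , b∉ , e , p) =
      a , b , x∈p-y⇒x∈p a∈ , a∉ ∘ (λ a∈S₂ → x∈p∧x≢y⇒x∈p-y a∈S₂ (x∈p-y⇒x≢y a∈)) ,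
      x∈p-y⇒x∈p b∈ , b∉ ∘ (λ b∈S₁ → x∈p∧x≢y⇒x∈p-y b∈S₁ (x∈p-y⇒x≢y b∈)) ,
      p-x≡q-x⇒p≡q (x∈p∧x≢y⇒x∈p-y x∈S₁ (x∈p-y⇒x≢y a∈ ∘ ≡sym)) (x∈p∧x≢y⇒x∈p-y x∈S₂ (x∈p-y⇒x≢y b∈ ∘ ≡sym))
        (trans (p─x─y≡p─y─x S₁ a x) (trans e (p─x─y≡p─y─x S₂ x b))) ,
      p

module _ {m} {P : Fin (suc m) → Fin (suc m) → Set} where

  Exchange-∷ : ∀ {y S₁ S₂} → Exchange P (y ∷ S₁) (y ∷ S₂) ⇔ Exchange (λ a b → P (suc a) (suc b)) S₁ S₂
  Exchange-∷ {y} = mk⇔ tail-exchange (λ (a , b , a∈ , a∉ , b∈ , b∉ , e , p) →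
    suc a , suc b , there a∈ , a∉ ∘ drop-there , there b∈ , b∉ ∘ drop-there , cong (y ∷_) e , p)
    where
    tail-exchange : ∀ {S₁ S₂} → Exchange P (y ∷ S₁) (y ∷ S₂) → Exchange (λ a b → P (suc a) (suc b)) S₁ S₂
    tail-exchange (zero , _ , here , zero∉ , _) = ⊥-elim (zero∉ here)
    tail-exchange (suc a , zero , _ , _ , here , zero∉ , _) = ⊥-elim (zero∉ here)
    tail-exchange (suc a , suc b , a∈ , a∉ , b∈ , b∉ , e , p) =
      a , b , drop-there a∈ , drop-not-there a∉ , drop-there b∈ , drop-not-there b∉ , ∷-injectiveʳ e , p

  Exchange-new : ∀ {B C} → Exchange P (true ∷ B) (false ∷ C) ⇔ (∃ λ b → b ∈ C × B ≡ C - b × P zero (suc b))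
  Exchange-new {B} {C} = mk⇔ entering (λ (b , b∈ , e , p) →
    zero , suc b , here , (λ ()) , there b∈ , (λ { (there b∈B) → x∉p-x C b (subst (b ∈_) e b∈B) }) ,
    cong (false ∷_) (trans (p─⊥≡p B) e) , p)
    where
    entering : Exchange P (true ∷ B) (false ∷ C) → ∃ λ b → b ∈ C × B ≡ C - b × P zero (suc b)
    entering (_ , zero , _ , _ , () , _)
    entering (zero , suc b , _ , _ , b∈ , _ , e , p) =
      b , drop-there b∈ , trans (≡sym (p─⊥≡p B)) (∷-injectiveʳ e) , p
    entering (suc a , suc b , _ , _ , _ , _ , e , _) with () ← ∷-injectiveˡ e

WPath-start : ∀ {m} {H : Graph m} {S x y} → WPath H S x y → x ∉ S
WPath-start (here x∉) = x∉
WPath-start (step x∉ _ _) = x∉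

WPath-end : ∀ {m} {H : Graph m} {S x y} → WPath H S x y → y ∉ S
WPath-end (here y∉) = y∉
WPath-end (step _ _ W) = WPath-end W

module Involution {m} (σ : Fin m → Fin m) (σ-involutive : ∀ i → σ (σ i) ≡ i) where

  Image : Subset m → Subset m → Set
  Image S S' = ∀ i → i ∈ S' ⇔ σ i ∈ S

  σ-swap : ∀ {x w} → σ x ≡ w → x ≡ σ w
  σ-swap {x} e = trans (≡sym (σ-involutive x)) (cong σ e)

  module _ {S S' : Subset m} (S↦S' : Image S S') where

    ∈-image : ∀ {x} → x ∈ S → σ x ∈ S'
    ∈-image {x} x∈ = from (S↦S' (σ x)) (subst (_∈ S) (≡sym (σ-involutive x)) x∈)

    ∉-image : ∀ {x} → x ∉ S → σ x ∉ S'
    ∉-image {x} x∉ σx∈ = x∉ (subst (_∈ S) (σ-involutive x) (to (S↦S' (σ x)) σx∈))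

    image-sym : Image S' S
    image-sym i = mk⇔ ∈-image (λ σi∈ → subst (_∈ S) (σ-involutive i) (to (S↦S' (σ i)) σi∈))

    image-unique : ∀ {S''} → Image S S'' → S' ≡ S''
    image-unique S↦S'' = ⊆-antisym (λ {i} h → from (S↦S'' i) (to (S↦S' i) h))
                                   (λ {i} h → from (S↦S' i) (to (S↦S'' i) h))

    image-∪⁅⁆ : ∀ w → Image (S ∪ ⁅ w ⁆) (S' ∪ ⁅ σ w ⁆)
    image-∪⁅⁆ w i = mk⇔ (x∈p∪⁅y⁆⁺ w ∘ forth ∘ x∈p∪⁅y⁆⁻ (σ w)) (x∈p∪⁅y⁆⁺ (σ w) ∘ back ∘ x∈p∪⁅y⁆⁻ w)
      where
      forth : i ∈ S' ⊎ i ≡ σ w → σ i ∈ S ⊎ σ i ≡ w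
      forth (inj₁ i∈) = inj₁ (to (S↦S' i) i∈)
      forth (inj₂ e) = inj₂ (trans (cong σ e) (σ-involutive w))
      back : σ i ∈ S ⊎ σ i ≡ w → i ∈ S' ⊎ i ≡ σ w
      back (inj₁ σi∈) = inj₁ (from (S↦S' i) σi∈)
      back (inj₂ e) = inj₂ (σ-swap e)

  module Automorphism (H : Graph m) (σ-adj : ∀ a b → adj H (σ a) (σ b) ≡ adj H a b) where

    Adj-σ : ∀ {a b} → Adj H a b → Adj H (σ a) (σ b)
    Adj-σ {a} {b} = trans (σ-adj a b)

    Adj-σˡ : ∀ {a b} → Adj H (σ a) b → Adj H a (σ b)
    Adj-σˡ {a} A = subst (λ z → Adj H z _) (σ-involutive a) (Adj-σ A)

    WPath-image : ∀ {S S'} → Image S S' → ∀ {x y} → WPath H S x y → WPath H S' (σ x) (σ y)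
    WPath-image S↦S' (here x∉) = here (∉-image S↦S' x∉)
    WPath-image S↦S' (step x∉ A W) = step (∉-image S↦S' x∉) (Adj-σ A) (WPath-image S↦S' W)

    Force-image : ∀ s {S S'} → Image S S' → ∀ {w} → Force s H S w → Force s H S' (σ w)
    Force-image pos {S} S↦S' {w} (w∉ , u , u∈ , A , only) =
      ∉-image S↦S' w∉ , σ u , ∈-image S↦S' u∈ , Adj-σ A , λ x Ax W →
        σ-swap (only (σ x) (Adj-σˡ Ax)
                 (subst (λ z → WPath H S z (σ x)) (σ-involutive w) (WPath-image (image-sym S↦S') W)))
    Force-image neg S↦S' (w∉ , u , A , only) =
      ∉-image S↦S' w∉ , σ u , Adj-σ A , λ x Ax x∉ → σ-swap (only (σ x) (Adj-σˡ Ax) (x∉ ∘ from (S↦S' x)))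

    Reach-image : ∀ s {S S' T T'} → Image S S' → Image T T' → Reach s H S T → Reach s H S' T'
    Reach-image s {S' = S'} S↦S' T↦T' done = subst (Reach s H S') (image-unique S↦S' T↦T') done
    Reach-image s S↦S' T↦T' (step w F R) =
      step (σ w) (Force-image s S↦S' F) (Reach-image s (image-∪⁅⁆ S↦S' w) T↦T' R)

    IsForcing-image : ∀ s {S S'} → Image S S' → IsForcing s H S → IsForcing s H S'
    IsForcing-image s S↦S' = Reach-image s S↦S' (λ _ → mk⇔ (λ _ → ∈⊤) (λ _ → ∈⊤))

joins : Sgn → Bool
joins pos = true
joins neg = false

∼-refl : ∀ {n} {v : Fin n} {x} → ∼[ v ] x x
∼-refl = refl , inj₁ refl

∼-sym : ∀ {n} {v : Fin n} {x y} → ∼[ v ] x y → ∼[ v ] y x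
∼-sym (refl , inj₁ refl) = ∼-refl
∼-sym (refl , inj₂ v∈) = refl , inj₂ v∈

module Twins {n} (G : Graph n) (v : Fin n) where

  G* : Sgn → Graph (suc n)
  G* s = duplicate (joins s) G v

  adj-new : ∀ s x → x ≢ v → adj (G* s) zero (suc x) ≡ adj G v x
  adj-new s x x≢v with v ≟ x
  ... | yes v≡x = ⊥-elim (x≢v (≡sym v≡x))
  ... | no _ = trans (cong (adj G v x ∨_) (∧-zeroʳ (joins s))) (∨-identityʳ (adj G v x))

  adj-new-v : ∀ s → adj (G* s) zero (suc v) ≡ joins s
  adj-new-v s with v ≟ v
  ... | yes _ = trans (cong (_∨ _) (irrefl G v)) (∧-identityʳ (joins s))
  ... | no v≢v = ⊥-elim (v≢v refl)

  σ : Fin (suc n) → Fin (suc n)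
  σ zero = suc v
  σ (suc x) with x ≟ v
  ... | yes _ = zero
  ... | no _ = suc x

  σ-v : σ (suc v) ≡ zero
  σ-v with v ≟ v
  ... | yes _ = refl
  ... | no v≢v = ⊥-elim (v≢v refl)

  σ-old : ∀ x → x ≢ v → σ (suc x) ≡ suc x
  σ-old x x≢v with x ≟ v
  ... | yes x≡v = ⊥-elim (x≢v x≡v)
  ... | no _ = refl

  data Vertex : Fin (suc n) → Set where
    new  : Vertex zero
    old-v : Vertex (suc v)
    old  : ∀ x → x ≢ v → Vertex (suc x)

  vertex : ∀ i → Vertex i
  vertex zero = new
  vertex (suc x) with x ≟ v
  ... | yes refl = old-v
  ... | no x≢v = old x x≢v

  σ-involutive : ∀ i → σ (σ i) ≡ i
  σ-involutive i with vertex i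
  ... | new = σ-v
  ... | old-v rewrite σ-v = refl
  ... | old x x≢v = trans (cong σ (σ-old x x≢v)) (σ-old x x≢v)

  σ-adj : ∀ s a b → adj (G* s) (σ a) (σ b) ≡ adj (G* s) a b
  σ-adj s a b with vertex a | vertex b
  ... | new | new = irrefl G v
  ... | new | old-v rewrite σ-v = sym (G* s) (suc v) zero
  ... | new | old y y≢v rewrite σ-old y y≢v = ≡sym (adj-new s y y≢v)
  ... | old-v | new rewrite σ-v = sym (G* s) zero (suc v)
  ... | old-v | old-v rewrite σ-v = ≡sym (irrefl G v)
  ... | old-v | old y y≢v rewrite σ-v | σ-old y y≢v = adj-new s y y≢v
  ... | old x x≢v | new rewrite σ-old x x≢v =
        trans (sym G x v) (trans (≡sym (adj-new s x x≢v)) (sym (G* s) zero (suc x)))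
  ... | old x x≢v | old-v rewrite σ-v | σ-old x x≢v =
        trans (sym (G* s) (suc x) zero) (trans (adj-new s x x≢v) (sym G v x))
  ... | old x x≢v | old y y≢v rewrite σ-old x x≢v | σ-old y y≢v = refl

  open Involution σ σ-involutive public
  open module Swap (s : Sgn) = Automorphism (G* s) (σ-adj s) public

  TwinsWhite : Subset (suc n) → Set
  TwinsWhite S = zero ∉ S × suc v ∉ S

  image-self : ∀ {S} → TwinsWhite S → Image S S
  image-self (zero∉ , v∉) i with vertex i
  ... | new = mk⇔ (⊥-elim ∘ zero∉) (⊥-elim ∘ v∉)
  ... | old-v rewrite σ-v = mk⇔ (⊥-elim ∘ v∉) (⊥-elim ∘ zero∉)
  ... | old x x≢v rewrite σ-old x x≢v = mk⇔ (λ h → h) (λ h → h)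

  σ-fixes-blue : ∀ {S u} → TwinsWhite S → u ∈ S → σ u ≡ u
  σ-fixes-blue {u = u} (zero∉ , v∉) u∈ with vertex u
  ... | new = ⊥-elim (zero∉ u∈)
  ... | old-v = ⊥-elim (v∉ u∈)
  ... | old x x≢v = σ-old x x≢v

  sees-both-twins : ∀ s {u} → σ u ≡ u → Adj (G* s) u zero → Adj (G* s) u (suc v)
  sees-both-twins s {u} e A = subst (λ z → Adj (G* s) z (suc v)) e (Adj-σ s {u} {zero} A)

  new-unforced : ∀ s {S} → TwinsWhite S → ¬ Force s (G* s) S zero
  new-unforced pos tw@(zero∉ , v∉) (_ , u , u∈ , A , only)
    with () ← only (suc v) (sees-both-twins pos (σ-fixes-blue tw u∈) A) (step zero∉ (adj-new-v pos) (here v∉))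
  new-unforced neg (zero∉ , v∉) (_ , u , A , only) with vertex u
  ... | new with () ← A
  ... | old-v with () ← trans (≡sym (trans (sym (G* neg) (suc v) zero) (adj-new-v neg))) A
  ... | old x x≢v with () ← only (suc v) (sees-both-twins neg (σ-old x x≢v) A) v∉

  v-unforced : ∀ s {S} → TwinsWhite S → ¬ Force s (G* s) S (suc v)
  v-unforced s {S} tw F = new-unforced s tw (subst (Force s (G* s) S) σ-v (Force-image s s (image-self tw) F))

  twins-stay-white : ∀ s {S T} → Reach s (G* s) S T → TwinsWhite S → TwinsWhite T
  twins-stay-white s done tw = tw
  twins-stay-white s {S} (step w F R) tw@(zero∉ , v∉) =
    twins-stay-white s R (stays-white zero∉ (new-unforced s tw) , stays-white v∉ (v-unforced s tw))
    where
    stays-white : ∀ {t} → t ∉ S → ¬ Force s (G* s) S t → t ∉ S ∪ ⁅ w ⁆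
    stays-white t∉ ¬F h with x∈p∪⁅y⁆⁻ w h
    ... | inj₁ t∈ = t∉ t∈
    ... | inj₂ refl = ¬F F

  IsForcing⇒v∈ : ∀ s {C} → IsForcing s (G* s) (false ∷ C) → v ∈ C
  IsForcing⇒v∈ s {C} F with v ∈? C
  ... | yes v∈ = v∈
  ... | no v∉ = ⊥-elim (proj₁ (twins-stay-white s F ((λ ()) , v∉ ∘ drop-there)) ∈⊤)

  WPath-lift : ∀ s {T a b} → WPath G T a b → WPath (G* s) (true ∷ T) (suc a) (suc b)
  WPath-lift s (here a∉) = here (a∉ ∘ drop-there)
  WPath-lift s (step a∉ A W) = step (a∉ ∘ drop-there) A (WPath-lift s W)

  WPath-lower : ∀ s {T a b} → WPath (G* s) (true ∷ T) (suc a) (suc b) → WPath G T a b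
  WPath-lower s (here a∉) = here (a∉ ∘ there)
  WPath-lower s (step {y = zero} _ _ W) = ⊥-elim (WPath-start W here)
  WPath-lower s (step {y = suc y} a∉ A W) = step (a∉ ∘ there) A (WPath-lower s W)

  Force-lift : ∀ s {T w} → Force s G T w → Force s (G* s) (true ∷ T) (suc w)
  Force-lift pos (w∉ , u , u∈ , A , only) = w∉ ∘ drop-there , suc u , there u∈ , A , λ
    { zero _ W → ⊥-elim (WPath-end W here)
    ; (suc x) Ax W → cong suc (only x Ax (WPath-lower pos W)) }
  Force-lift neg (w∉ , u , A , only) = w∉ ∘ drop-there , suc u , A , λ
    { zero _ x∉ → ⊥-elim (x∉ here)
    ; (suc x) Ax x∉ → cong suc (only x Ax (x∉ ∘ there)) }

  -- If v⁺ forces v, all of N_G(v) is blue (a white neighbour would share the white component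
  -- of v), so any neighbour of v forces v: this is where v must not be isolated.
  -- If v⁺ forces w ≠ v, then v is blue and forces w.
  new-force-lower : NonIsolated G v → ∀ {T w} → suc w ∉ true ∷ T → Adj (G* pos) zero (suc w) →
    (∀ x → Adj (G* pos) zero x → WPath (G* pos) (true ∷ T) (suc w) x → x ≡ suc w) → Force pos G T w
  new-force-lower (a , Ava) {T} {w} w∉ A only with w ≟ v
  ... | yes refl = w∉ ∘ there , a , N[v]⊆T a Ava , trans (sym G a v) Ava , λ
    { x _ (here _) → refl
    ; x _ (step _ Avy W) → ⊥-elim (WPath-start W (N[v]⊆T _ Avy)) }
    where
    N[v]⊆T : ∀ x → Adj G v x → x ∈ T
    N[v]⊆T x Avx with x ∈? T
    ... | yes x∈ = x∈
    ... | no x∉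
      with refl ← suc-injective (only (suc x) (cong (_∨ _) Avx) (step w∉ Avx (here (x∉ ∘ drop-there))))
      with () ← trans (≡sym Avx) (irrefl G v)
  ... | no w≢v = w∉ ∘ there , v , v∈T , Avw , λ x Avx W →
    suc-injective (only (suc x) (cong (_∨ _) Avx) (WPath-lift pos W))
    where
    Avw : Adj G v w
    Avw = trans (≡sym (adj-new pos w w≢v)) A
    v∈T : v ∈ T
    v∈T with v ∈? T
    ... | yes v∈ = v∈
    ... | no v∉ = ⊥-elim (w≢v (≡sym (suc-injective
      (only (suc v) (adj-new-v pos) (step w∉ (trans (sym G w v) Avw) (here (v∉ ∘ drop-there)))))))

  Force-lower : ∀ s → (s ≡ pos → NonIsolated G v) → ∀ {T w} →
                Force s (G* s) (true ∷ T) (suc w) → Force s G T w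
  Force-lower pos ni (w∉ , zero , _ , A , only) = new-force-lower (ni refl) w∉ A only
  Force-lower pos _ (w∉ , suc u , u∈ , A , only) =
    w∉ ∘ there , u , drop-there u∈ , A , λ x Ax W → suc-injective (only (suc x) Ax (WPath-lift pos W))
  Force-lower neg _ (w∉ , zero , A , only) =
    w∉ ∘ there , v , trans (≡sym (∨-identityʳ _)) A ,
    λ x Ax x∉ → suc-injective (only (suc x) (trans (∨-identityʳ _) Ax) (x∉ ∘ drop-there))
  Force-lower neg _ (w∉ , suc u , A , only) =
    w∉ ∘ there , u , A , λ x Ax x∉ → suc-injective (only (suc x) Ax (x∉ ∘ drop-there))

  Reach-lift : ∀ s {B T} → Reach s G B T → Reach s (G* s) (true ∷ B) (true ∷ T)
  Reach-lift s done = done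
  Reach-lift s (step w F R) = step (suc w) (Force-lift s F) (Reach-lift s R)

  Reach-lower : ∀ s → (s ≡ pos → NonIsolated G v) → ∀ {B X} → Reach s (G* s) (true ∷ B) X → Reach s G B (tail X)
  Reach-lower s ni done = done
  Reach-lower pos ni (step zero (w∉ , _) R) = ⊥-elim (w∉ here)
  Reach-lower neg ni (step zero (w∉ , _) R) = ⊥-elim (w∉ here)
  Reach-lower s ni (step (suc w) F R) = step w (Force-lower s ni F) (Reach-lower s ni R)

  project : Subset (suc n) → Subset n × Bool
  project (true ∷ B) = B , true
  project (false ∷ C) = C - v , false

  swap-image : ∀ {C} → v ∈ C → Image (false ∷ C) (true ∷ (C - v))
  swap-image {C} v∈ i with vertex i
  ... | new = mk⇔ (λ _ → there v∈) (λ _ → here)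
  ... | old-v rewrite σ-v = mk⇔ (⊥-elim ∘ x∉p-x C v ∘ drop-there) (λ ())
  ... | old x x≢v rewrite σ-old x x≢v =
        mk⇔ (there ∘ x∈p-y⇒x∈p ∘ drop-there) (λ x∈ → there (x∈p∧x≢y⇒x∈p-y (drop-there x∈) x≢v))

  module Minimum (s : Sgn) (ni : s ≡ pos → NonIsolated G v) where

    project-forcing : ∀ S → IsForcing s (G* s) S →
                      IsForcing s G (proj₁ (project S)) × ∣ S ∣ ≡ suc ∣ proj₁ (project S) ∣
    project-forcing (true ∷ B) F = Reach-lower s ni F , refl
    project-forcing (false ∷ C) F =
      Reach-lower s ni (IsForcing-image s s (swap-image v∈) F) , ∣p∣≡1+∣p-x∣ C v v∈
      where v∈ = IsForcing⇒v∈ s F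

    IsMinForcing⇒1+∣B∣≤ : ∀ {B} → IsMinForcing s G B → ∀ T → IsForcing s (G* s) T → suc ∣ B ∣ ≤ ∣ T ∣
    IsMinForcing⇒1+∣B∣≤ (_ , minimal) T F =
      ≤-trans (s≤s (minimal _ (proj₁ (project-forcing T F)))) (≤-reflexive (≡sym (proj₂ (project-forcing T F))))

    IsMinForcing-new : ∀ {B} → IsMinForcing s G B → IsMinForcing s (G* s) (true ∷ B)
    IsMinForcing-new m@(F , _) = Reach-lift s F , IsMinForcing⇒1+∣B∣≤ m

    IsMinForcing-v : ∀ {B} → IsMinForcing s G B → v ∉ B → IsMinForcing s (G* s) (false ∷ (B ∪ ⁅ v ⁆))
    IsMinForcing-v {B} m@(F , _) v∉ =
      IsForcing-image s s (image-sym v↦new) (Reach-lift s F) ,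
      λ T F' → ≤-trans (≤-reflexive ∣B∪v∣) (IsMinForcing⇒1+∣B∣≤ m T F')
      where
      v∈ : v ∈ B ∪ ⁅ v ⁆
      v∈ = x∈p∪⁅y⁆⁺ v (inj₂ refl)
      v↦new : Image (false ∷ (B ∪ ⁅ v ⁆)) (true ∷ B)
      v↦new = subst (λ X → Image (false ∷ (B ∪ ⁅ v ⁆)) (true ∷ X)) (p∪⁅x⁆-x≡p v∉) (swap-image v∈)
      ∣B∪v∣ : ∣ B ∪ ⁅ v ⁆ ∣ ≡ suc ∣ B ∣
      ∣B∪v∣ = trans (∣p∣≡1+∣p-x∣ (B ∪ ⁅ v ⁆) v v∈) (cong (suc ∘ ∣_∣) (p∪⁅x⁆-x≡p v∉))

    IsMinForcing-project : ∀ {S} → IsMinForcing s (G* s) S → IsMinForcing s G (proj₁ (project S))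
    IsMinForcing-project {S} (F , minimal) =
      proj₁ (project-forcing S F) ,
      λ T F' → s≤s⁻¹ (≤-trans (≤-reflexive (≡sym (proj₂ (project-forcing S F))))
                               (minimal (true ∷ T) (Reach-lift s F')))

  module Isomorphism (s : Sgn) (ni : s ≡ pos → NonIsolated G v) (c : Bool) where
    open Minimum s ni

    -- Edges of TE(G) □ P₂ (c = false) or TS(G) □ P₂ resp. 2 TS(G) (c = true); the P₂-edge
    -- is present exactly when v⋆ v is an allowed exchange in G⋆.
    Layered : Subset n × Bool → Subset n × Bool → Set
    Layered (B , i) (B' , j) =
      (B ≡ B' × i ≢ j × Label c (G* s) zero (suc v)) ⊎ (Exchange (Label c G) B B' × i ≡ j)

    Layers : (Subset n × Bool → Subset n × Bool → Set) → AGraph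
    Layers EH = record { V = Subset n × Bool ; Vert = IsMinForcing s G ∘ proj₁ ; _≈_ = _≡_ ; E = EH }

    QEdge : Subset n × Bool → Subset n × Bool → Set
    QEdge = E (Layers Layered / ∼[ v ])

    QEdge-sym : ∀ {x y} → QEdge x y → QEdge y x
    QEdge-sym (≁ , x' , y' , m , m' , x∼x' , y∼y' , L) =
      ≁ ∘ ∼-sym , y' , x' , m' , m , y∼y' , x∼x' , Layered-sym L
      where
      Layered-sym : ∀ {x y} → Layered x y → Layered y x
      Layered-sym (inj₁ (e , i≢j , ℓ)) = inj₁ (≡sym e , i≢j ∘ ≡sym , ℓ)
      Layered-sym (inj₂ (x , i≡j)) = inj₂ (Exchange-sym (Label-sym c G) x , ≡sym i≡j)

    QEdge-layer : ∀ {B₁ B₂ i} → IsMinForcing s G B₁ → IsMinForcing s G B₂ →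
                  QEdge (B₁ , i) (B₂ , i) ⇔ Exchange (Label c G) B₁ B₂
    QEdge-layer {B₁} {B₂} {i} m₁ m₂ = mk⇔ exchange
      (λ x → ≢ x ∘ proj₁ , (B₁ , i) , (B₂ , i) , m₁ , m₂ , ∼-refl , ∼-refl , inj₂ (x , refl))
      where
      exchange : QEdge (B₁ , i) (B₂ , i) → Exchange (Label c G) B₁ B₂
      exchange (≁ , _ , _ , _ , _ , (refl , _) , (refl , _) , inj₁ (e , _)) = ⊥-elim (≁ (e , inj₁ refl))
      exchange (≁ , _ , _ , _ , _ , (refl , _) , (refl , _) , inj₂ (x , _)) = x
      ≢ : Exchange (Label c G) B₁ B₂ → B₁ ≢ B₂
      ≢ (_ , _ , a∈ , a∉ , _) refl = a∉ a∈

    QEdge-across : ∀ {B C} → IsMinForcing s G B → v ∈ C → IsMinForcing s G (C - v) →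
                   QEdge (B , true) (C - v , false) ⇔ (∃ λ b → b ∈ C × B ≡ C - b × Label c (G* s) zero (suc b))
    QEdge-across {B} {C} m v∈C m' = mk⇔ entering exchange
      where
      ≁ : ¬ ∼[ v ] (B , true) (C - v , false)
      ≁ (e , inj₂ v∈B) = x∉p-x C v (subst (v ∈_) e v∈B)

      entering : QEdge (B , true) (C - v , false) → ∃ λ b → b ∈ C × B ≡ C - b × Label c (G* s) zero (suc b)
      entering (_ , _ , _ , _ , _ , _ , (refl , inj₂ v∈C-v) , _) = ⊥-elim (x∉p-x C v v∈C-v)
      entering (_ , _ , _ , _ , _ , (refl , _) , (refl , inj₁ refl) , inj₁ (e , _ , ℓ)) = v , v∈C , e , ℓ
      entering (_ , _ , _ , _ , _ , (refl , inj₂ v∈B) , (refl , inj₁ refl) , inj₂ (x , refl))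
        with b , b∈ , _ , e , ℓ ← Exchange-leaving v∈B (x∉p-x C v) x =
        b , x∈p-y⇒x∈p b∈ ,
        p-x≡q-x⇒p≡q v∈B (x∈p∧x≢y⇒x∈p-y v∈C (b≢v ∘ ≡sym)) (trans e (p─x─y≡p─y─x C v b)) ,
        λ t → trans (adj-new s b b≢v) (ℓ t)
        where b≢v = x∈p-y⇒x≢y b∈

      exchange : (∃ λ b → b ∈ C × B ≡ C - b × Label c (G* s) zero (suc b)) → QEdge (B , true) (C - v , false)
      exchange (b , b∈ , e , ℓ) with b ≟ v
      ... | yes refl = ≁ , (B , true) , (C - v , false) , m , m' , ∼-refl , ∼-refl , inj₁ (e , (λ ()) , ℓ)
      ... | no b≢v =
        ≁ , (B , false) , (C - v , false) , m , m' , (refl , inj₂ v∈B) , ∼-refl ,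
        inj₂ (subst (λ X → Exchange (Label c G) X (C - v)) (≡sym e)
                (Exchange-swap v∈C b∈ (b≢v ∘ ≡sym) λ t → trans (≡sym (adj-new s b b≢v)) (ℓ t)) , refl)
        where
        v∈B : v ∈ B
        v∈B = subst (v ∈_) (≡sym e) (x∈p∧x≢y⇒x∈p-y v∈C (b≢v ∘ ≡sym))

    Exchange⇔QEdge : ∀ {S₁ S₂} → IsMinForcing s (G* s) S₁ → IsMinForcing s (G* s) S₂ →
                     Exchange (Label c (G* s)) S₁ S₂ ⇔ QEdge (project S₁) (project S₂)
    Exchange⇔QEdge {true ∷ B₁} {true ∷ B₂} m₁ m₂ =
      ⇔-trans Exchange-∷ (⇔-sym (QEdge-layer (IsMinForcing-project m₁) (IsMinForcing-project m₂)))
    Exchange⇔QEdge {false ∷ C₁} {false ∷ C₂} m₁ m₂ =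
      ⇔-trans Exchange-∷ (⇔-trans (Exchange-remove (IsForcing⇒v∈ s (proj₁ m₁)) (IsForcing⇒v∈ s (proj₁ m₂)))
        (⇔-sym (QEdge-layer (IsMinForcing-project m₁) (IsMinForcing-project m₂))))
    Exchange⇔QEdge {true ∷ B} {false ∷ C} m₁ m₂ =
      ⇔-trans Exchange-new
        (⇔-sym (QEdge-across (IsMinForcing-project m₁) (IsForcing⇒v∈ s (proj₁ m₂)) (IsMinForcing-project m₂)))
    Exchange⇔QEdge {false ∷ C} {true ∷ B} m₁ m₂ = mk⇔
      (QEdge-sym ∘ to (Exchange⇔QEdge m₂ m₁) ∘ Exchange-sym (Label-sym c (G* s)))
      (Exchange-sym (Label-sym c (G* s)) ∘ from (Exchange⇔QEdge m₂ m₁) ∘ QEdge-sym)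

    project-injective : ∀ {S₁ S₂} → IsMinForcing s (G* s) S₁ → IsMinForcing s (G* s) S₂ →
                        ∼[ v ] (project S₁) (project S₂) → S₁ ≡ S₂
    project-injective {true ∷ B₁} {true ∷ B₂} _ _ (e , _) = cong (true ∷_) e
    project-injective {false ∷ C₁} {false ∷ C₂} m₁ m₂ (e , _) =
      cong (false ∷_) (p-x≡q-x⇒p≡q (IsForcing⇒v∈ s (proj₁ m₁)) (IsForcing⇒v∈ s (proj₁ m₂)) e)
    project-injective {true ∷ B} {false ∷ C} _ _ (e , inj₂ v∈B) = ⊥-elim (x∉p-x C v (subst (v ∈_) e v∈B))
    project-injective {false ∷ C} {true ∷ B} _ _ (_ , inj₂ v∈C-v) = ⊥-elim (x∉p-x C v v∈C-v)

    project-surjective : ∀ y → IsMinForcing s G (proj₁ y) →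
                         ∃ λ S → IsMinForcing s (G* s) S × ∼[ v ] (project S) y
    project-surjective (B , true) m = true ∷ B , IsMinForcing-new m , ∼-refl
    project-surjective (B , false) m with v ∈? B
    ... | yes v∈ = true ∷ B , IsMinForcing-new m , refl , inj₂ v∈
    ... | no v∉ = false ∷ (B ∪ ⁅ v ⁆) , IsMinForcing-v m v∉ , p∪⁅x⁆-x≡p v∉ , inj₁ refl

    dup-iso : (E* : Subset (suc n) → Subset (suc n) → Set) (EH : Subset n × Bool → Subset n × Bool → Set) →
      (∀ {S₁ S₂} → E* S₁ S₂ ⇔ Exchange (Label c (G* s)) S₁ S₂) →
      (∀ {B B' i j} → EH (B , i) (B' , j) ⇔ Layered (B , i) (B' , j)) →
      record { V = Subset (suc n) ; Vert = IsMinForcing s (G* s) ; _≈_ = _≡_ ; E = E* } ≅ (Layers EH / ∼[ v ])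
    dup-iso E* EH E*⇔ EH⇔ = record
      { f = project
      ; pres = IsMinForcing-project
      ; eqv = λ m₁ m₂ → (λ { refl → ∼-refl }) , project-injective m₁ m₂
      ; surj = project-surjective
      ; edges = λ m₁ m₂ → let e = ⇔-trans E*⇔ (⇔-trans (Exchange⇔QEdge m₁ m₂) QEdge⇔) in to e , from e
      }
      where
      QEdge⇔ : ∀ {x y} → QEdge x y ⇔ E (Layers EH / ∼[ v ]) x y
      QEdge⇔ = mk⇔ (λ (≁ , x' , y' , m , m' , r , r' , L) → ≁ , x' , y' , m , m' , r , r' , from EH⇔ L)
                   (λ (≁ , x' , y' , m , m' , r , r' , L) → ≁ , x' , y' , m , m' , r , r' , to EH⇔ L)

□P₂-edge⇔ : ∀ {A : Set} {x y : A} {i j : Bool} {R R' L : Set} → L → R ⇔ R' →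
  ((x ≡ y × i ≢ j) ⊎ (R × i ≡ j)) ⇔ ((x ≡ y × i ≢ j × L) ⊎ (R' × i ≡ j))
□P₂-edge⇔ ℓ R⇔R' = mk⇔ (λ { (inj₁ (e , i≢j)) → inj₁ (e , i≢j , ℓ) ; (inj₂ (r , i≡j)) → inj₂ (to R⇔R' r , i≡j) })
                        (λ { (inj₁ (e , i≢j , _)) → inj₁ (e , i≢j) ; (inj₂ (r , i≡j)) → inj₂ (from R⇔R' r , i≡j) })

2·-edge⇔ : ∀ {A : Set} {x y : A} {i j : Bool} {R R' L : Set} → ¬ L → R ⇔ R' →
  (R × i ≡ j) ⇔ ((x ≡ y × i ≢ j × L) ⊎ (R' × i ≡ j))
2·-edge⇔ ¬ℓ R⇔R' = mk⇔ (λ (r , i≡j) → inj₂ (to R⇔R' r , i≡j))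
                       (λ { (inj₁ (_ , _ , ℓ)) → ⊥-elim (¬ℓ ℓ) ; (inj₂ (r , i≡j)) → from R⇔R' r , i≡j })

TEEdge⇔Exchange : ∀ {m} (H : Graph m) {S₁ S₂} → TEEdge S₁ S₂ ⇔ Exchange (Label false H) S₁ S₂
TEEdge⇔Exchange _ = mk⇔ (λ (a , b , a∈ , a∉ , b∈ , b∉ , e) → a , b , a∈ , a∉ , b∈ , b∉ , e , λ ())
                      (λ (a , b , a∈ , a∉ , b∈ , b∉ , e , _) → a , b , a∈ , a∉ , b∈ , b∉ , e)

TSEdge⇔Exchange : ∀ {m} (H : Graph m) {S₁ S₂} → TSEdge H S₁ S₂ ⇔ Exchange (Label true H) S₁ S₂
TSEdge⇔Exchange _ = mk⇔ (Exchange-map λ A _ → A) (Exchange-map λ ℓ → ℓ tt)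

mainTheorem20 : ∀ {n} (G : Graph n) (v : Fin n) →
    ((s : Sgn) → (s ≡ pos → NonIsolated G v) →
        TE s (dup s G v) ≅ ((TE s G □P₂) / ∼[ v ]))
    × (NonIsolated G v → TS pos (dup pos G v) ≅ ((TS pos G □P₂) / ∼[ v ]))
    × (TS neg (dup neg G v) ≅ (2· (TS neg G) / ∼[ v ]))
mainTheorem20 G v = TE-iso , TS⁺-iso , TS⁻-iso
  where
  open Twins G v

  TE*-iso : ∀ s → (s ≡ pos → NonIsolated G v) → TE s (G* s) ≅ ((TE s G □P₂) / ∼[ v ])
  TE*-iso s ni = Isomorphism.dup-iso s ni false _ _ (TEEdge⇔Exchange (G* s))
                   (□P₂-edge⇔ (λ ()) (TEEdge⇔Exchange G))

  -- dup s G v unfolds to G* s only once s is a constructor.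
  TE-iso : ∀ s → (s ≡ pos → NonIsolated G v) → TE s (dup s G v) ≅ ((TE s G □P₂) / ∼[ v ])
  TE-iso pos = TE*-iso pos
  TE-iso neg = TE*-iso neg

  TS⁺-iso : NonIsolated G v → TS pos (G* pos) ≅ ((TS pos G □P₂) / ∼[ v ])
  TS⁺-iso nv = Isomorphism.dup-iso pos (λ _ → nv) true _ _ (TSEdge⇔Exchange (G* pos))
                 (□P₂-edge⇔ (λ _ → adj-new-v pos) (TSEdge⇔Exchange G))

  TS⁻-iso : TS neg (G* neg) ≅ (2· (TS neg G) / ∼[ v ])
  TS⁻-iso = Isomorphism.dup-iso neg (λ ()) true _ _ (TSEdge⇔Exchange (G* neg))
              (2·-edge⇔ no-twin-edge (TSEdge⇔Exchange G))
    where
    no-twin-edge : ¬ Label true (G* neg) zero (suc v)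
    no-twin-edge ℓ with () ← trans (≡sym (ℓ tt)) (adj-new-v neg)
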